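{- Let $m\ge 4$ and $n>m$. Let $G_1=C_m(n-m)$ and $G_2=C_{m-1}(n-m+1)$, both unicyclic graphs of order $n$. Then $HM(G_1)<HM(G_2)$.
   Context: $C_m(p)$ denotes the unicyclic graph obtained from the cycle $C_m$ by attaching $p$ pendant vertices to one vertex of the cycle. $HM(G)=\sum_{xy\in E(G)}(d_G(x)+d_G(y))^2$, where $d_G$ is the vertex degree. -}

module Defs where

open import Data.Nat using (ℕ; zero; suc; _+_; _*_; _∸_)
open import Data.Nat.Properties using (_≟_)
open import Data.Bool using (Bool; true; false; _∨_)
open import Data.List using (List; []; _∷_; map; upTo; length; _++_)
open import Data.Nat.ListAction using (sum)
open import Data.Product using (_×_; _,_)
open import Relation.Nullary.Decidable using (⌊_⌋)

-- A finite simple graph given by its vertex count and list of edges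
-- (each edge an unordered pair, listed once as (x , y)).
record Graph : Set where
  constructor graph
  field
    order : ℕ
    edges : List (ℕ × ℕ)

open Graph public

deg : Graph → ℕ → ℕ
deg G v = sum (map (λ e → inc e) (edges G))
  where
  inc : ℕ × ℕ → ℕ
  inc (x , y) with ⌊ x ≟ v ⌋ ∨ ⌊ y ≟ v ⌋
  ... | true  = 1
  ... | false = 0

HM : Graph → ℕ
HM G = sum (map (λ e → sq e) (edges G))
  where
  sq : ℕ × ℕ → ℕ
  sq (x , y) = (deg G x + deg G y) * (deg G x + deg G y)

cycleEdges : ℕ → List (ℕ × ℕ)
cycleEdges m = map (λ i → (i , suc i)) (upTo (m ∸ 1)) ++ ((m ∸ 1 , 0) ∷ [])

-- C_m(p): C_m with p pendant vertices m,…,m+p-1 attached to vertex 0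
-- (intended for m ≥ 3)
Cmp : ℕ → ℕ → Graph
Cmp m p = graph (m + p) (cycleEdges m ++ map (λ j → (0 , m + j)) (upTo p))

-- In C_m(p) the root has degree p + 2, the other cycle vertices degree 2 and the
-- pendant vertices degree 1, so HM(C_m(p)) = 2(p + 4)² + 16(m − 2) + p(p + 3)².
-- Passing from C_m(p) to C_{m−1}(p + 1) raises this by 3p² + 19p + 18 > 0.
module Submission where

open import Defs
open import Data.Nat using (ℕ; zero; suc; _+_; _*_; _∸_; _≤_; _<_; s≤s; z≤n)
open import Data.Nat.Properties
open import Data.Nat.ListAction using (sum)
open import Data.Nat.ListAction.Properties using (sum-++)
open import Data.Nat.Tactic.RingSolver using (solve-∀)
open import Data.Product using (_×_; _,_; proj₁)
open import Data.Sum using (inj₁; inj₂)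
open import Data.List using (List; []; _∷_; _++_; map; applyUpTo)
open import Data.List.Properties using (map-++; map-cong; map-upTo)
open import Relation.Binary.PropositionalEquality
open import Relation.Nullary using (yes; no; contradiction)

incident : ℕ → ℕ × ℕ → ℕ
incident v (x , y) with x ≟ v | y ≟ v
... | yes _ | _     = 1
... | no _  | yes _ = 1
... | no _  | no _  = 0

incident-left : ∀ v y → incident v (v , y) ≡ 1
incident-left v y with v ≟ v
... | yes _   = refl
... | no v≢v  = contradiction refl v≢v

incident-right : ∀ x v → incident v (x , v) ≡ 1
incident-right x v with x ≟ v | v ≟ v
... | yes _ | _       = refl
... | no _  | yes _   = refl
... | no _  | no v≢v  = contradiction refl v≢v

incident-miss : ∀ {x y v} → x ≢ v → y ≢ v → incident v (x , y) ≡ 0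
incident-miss {x} {y} {v} x≢v y≢v with x ≟ v | y ≟ v
... | yes x≡v | _       = contradiction x≡v x≢v
... | no _    | yes y≡v = contradiction y≡v y≢v
... | no _    | no _    = refl

degreeIn : List (ℕ × ℕ) → ℕ → ℕ
degreeIn es v = sum (map (incident v) es)

degreeIn-++ : ∀ xs ys v → degreeIn (xs ++ ys) v ≡ degreeIn xs v + degreeIn ys v
degreeIn-++ xs ys v = trans (cong sum (map-++ (incident v) xs ys)) (sum-++ (map (incident v) xs) _)

-- `deg` counts incidences with a function local to its definition; unification names it.
private
  incidenceOf : Graph → ℕ → ℕ × ℕ → ℕ
  incidenceOf G v = proj₁ {B = λ f → deg G v ≡ sum (map f (edges G))} (_ , refl)

  incidenceOf≡incident : ∀ G v x y → incidenceOf G v (x , y) ≡ incident v (x , y)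
  incidenceOf≡incident G v x y with x ≟ v | y ≟ v
  ... | yes _ | _     = refl
  ... | no _  | yes _ = refl
  ... | no _  | no _  = refl

deg≡degreeIn : ∀ G v → deg G v ≡ degreeIn (edges G) v
deg≡degreeIn G v = cong sum (map-cong (λ (x , y) → incidenceOf≡incident G v x y) (edges G))

hyperZagreb : (ℕ → ℕ) → List (ℕ × ℕ) → ℕ
hyperZagreb d es = sum (map (λ (x , y) → (d x + d y) * (d x + d y)) es)

hyperZagreb-++ : ∀ d xs ys → hyperZagreb d (xs ++ ys) ≡ hyperZagreb d xs + hyperZagreb d ys
hyperZagreb-++ d xs ys = trans (cong sum (map-++ _ xs ys)) (sum-++ (map _ xs) _)

path : ℕ → ℕ → List (ℕ × ℕ)
path s zero    = []
path s (suc N) = (s , suc s) ∷ path (suc s) N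

applyUpTo-path : ∀ s N {f : ℕ → ℕ × ℕ} → (∀ i → f i ≡ (s + i , suc (s + i))) →
                 applyUpTo f N ≡ path s N
applyUpTo-path s zero    f≗ = refl
applyUpTo-path s (suc N) f≗ =
  cong₂ _∷_ (trans (f≗ 0) (cong (λ x → x , suc x) (+-identityʳ s)))
            (applyUpTo-path (suc s) N (λ i → trans (f≗ (suc i)) (cong (λ x → x , suc x) (+-suc s i))))

degreeIn-path-below : ∀ s N {v} → v < s → degreeIn (path s N) v ≡ 0
degreeIn-path-below s zero    v<s = refl
degreeIn-path-below s (suc N) v<s =
  cong₂ _+_ (incident-miss (>⇒≢ v<s) (>⇒≢ (m<n⇒m<1+n v<s)))
            (degreeIn-path-below (suc s) N (m<n⇒m<1+n v<s))

degreeIn-path-above : ∀ s N {v} → s + N < v → degreeIn (path s N) v ≡ 0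
degreeIn-path-above s zero    s+N<v = refl
degreeIn-path-above s (suc N) {v} s+N<v =
  cong₂ _+_ (incident-miss (<⇒≢ (<-trans (n<1+n s) 1+s<v)) (<⇒≢ 1+s<v))
            (degreeIn-path-above (suc s) N 1+s+N<v)
  where
  1+s+N<v : suc s + N < v
  1+s+N<v = subst (_< v) (+-suc s N) s+N<v
  1+s<v : suc s < v
  1+s<v = ≤-<-trans (s≤s (m≤m+n s N)) 1+s+N<v

degreeIn-path-start : ∀ s N → degreeIn (path s (suc N)) s ≡ 1
degreeIn-path-start s N =
  cong₂ _+_ (incident-left s (suc s)) (degreeIn-path-below (suc s) N (n<1+n s))

degreeIn-path-end : ∀ s N → degreeIn (path s (suc N)) (suc (s + N)) ≡ 1
degreeIn-path-end s zero rewrite +-identityʳ s = cong (_+ 0) (incident-right s (suc s))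
degreeIn-path-end s (suc N) =
  cong₂ _+_ (incident-miss (<⇒≢ (s≤s (m≤m+n s (suc N)))) (<⇒≢ (s≤s (m<m+n s (s≤s z≤n)))))
            (subst (λ w → degreeIn (path (suc s) (suc N)) (suc w) ≡ 1) (sym (+-suc s N))
                   (degreeIn-path-end (suc s) N))

degreeIn-path-interior : ∀ s N {v} → s < v → v < s + N → degreeIn (path s N) v ≡ 2
degreeIn-path-interior s zero s<v v<s+0 =
  contradiction (subst (_ <_) (+-identityʳ s) v<s+0) (<-asym s<v)
degreeIn-path-interior s (suc N) {v} s<v v<s+N with v ≟ suc s
degreeIn-path-interior s (suc zero) s<v 1+s<s+1 | yes refl =
  contradiction (subst (suc s <_) (+-comm s 1) 1+s<s+1) (n≮n _)
degreeIn-path-interior s (suc (suc N)) s<v v<s+N | yes refl =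
  cong₂ _+_ (incident-right s (suc s)) (degreeIn-path-start (suc s) N)
... | no v≢1+s =
  cong₂ _+_ (incident-miss (<⇒≢ s<v) (≢-sym v≢1+s))
            (degreeIn-path-interior (suc s) N (≤∧≢⇒< s<v (≢-sym v≢1+s)) (subst (v <_) (+-suc s N) v<s+N))

hyperZagreb-path : ∀ d s N {c} → (∀ {v} → s ≤ v → v ≤ s + N → d v ≡ c) →
                   hyperZagreb d (path s N) ≡ N * ((c + c) * (c + c))
hyperZagreb-path d s zero    d≡c = refl
hyperZagreb-path d s (suc N) d≡c =
  cong₂ _+_ (cong₂ (λ a b → (a + b) * (a + b)) (d≡c ≤-refl (m≤m+n s (suc N)))
                                               (d≡c (n≤1+n s) (m<m+n s (s≤s z≤n))))
            (hyperZagreb-path d (suc s) N (λ {v} s<v v≤ → d≡c (<⇒≤ s<v) (subst (v ≤_) (sym (+-suc s N)) v≤)))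

-- The cycle C_{N+2} on the vertices 0, …, N+1.
cycle : ℕ → List (ℕ × ℕ)
cycle N = path 0 (suc N) ++ (suc N , 0) ∷ []

cycleEdges≡cycle : ∀ N → cycleEdges (2 + N) ≡ cycle N
cycleEdges≡cycle N =
  cong (_++ (suc N , 0) ∷ []) (trans (map-upTo _ (suc N)) (applyUpTo-path 0 (suc N) (λ i → refl)))

degreeIn-cycle : ∀ N {v} → v ≤ suc N → degreeIn (cycle N) v ≡ 2
degreeIn-cycle N {v} v≤1+N = trans (degreeIn-++ (path 0 (suc N)) _ v) (on-cycle v v≤1+N)
  where
  on-cycle : ∀ v → v ≤ suc N → degreeIn (path 0 (suc N)) v + degreeIn ((suc N , 0) ∷ []) v ≡ 2
  on-cycle zero _ = cong₂ _+_ (degreeIn-path-start 0 N) (cong (_+ 0) (incident-right (suc N) 0))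
  on-cycle (suc w) (s≤s w≤N) with m≤n⇒m<n∨m≡n w≤N
  ... | inj₁ w<N  = cong₂ _+_ (degreeIn-path-interior 0 (suc N) (s≤s z≤n) (s≤s w<N))
                              (cong (_+ 0) (incident-miss (>⇒≢ (s≤s w<N)) (λ ())))
  ... | inj₂ refl = cong₂ _+_ (degreeIn-path-end 0 N) (cong (_+ 0) (incident-left (suc N) 0))

degreeIn-cycle-above : ∀ N {v} → suc N < v → degreeIn (cycle N) v ≡ 0
degreeIn-cycle-above N {v} 1+N<v =
  trans (degreeIn-++ (path 0 (suc N)) _ v)
        (cong₂ _+_ (degreeIn-path-above 0 (suc N) 1+N<v)
                   (cong (_+ 0) (incident-miss (<⇒≢ 1+N<v) (<⇒≢ (≤-trans (s≤s z≤n) 1+N<v)))))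

star : ℕ → ℕ → ℕ → List (ℕ × ℕ)
star c s zero    = []
star c s (suc p) = (c , s) ∷ star c (suc s) p

applyUpTo-star : ∀ c s p {f : ℕ → ℕ × ℕ} → (∀ i → f i ≡ (c , s + i)) →
                 applyUpTo f p ≡ star c s p
applyUpTo-star c s zero    f≗ = refl
applyUpTo-star c s (suc p) f≗ =
  cong₂ _∷_ (trans (f≗ 0) (cong (c ,_) (+-identityʳ s)))
            (applyUpTo-star c (suc s) p (λ i → trans (f≗ (suc i)) (cong (c ,_) (+-suc s i))))

degreeIn-star-centre : ∀ c s p → degreeIn (star c s p) c ≡ p
degreeIn-star-centre c s zero    = refl
degreeIn-star-centre c s (suc p) = cong₂ _+_ (incident-left c s) (degreeIn-star-centre c (suc s) p)

degreeIn-star-below : ∀ c s p {v} → c ≢ v → v < s → degreeIn (star c s p) v ≡ 0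
degreeIn-star-below c s zero    c≢v v<s = refl
degreeIn-star-below c s (suc p) c≢v v<s =
  cong₂ _+_ (incident-miss c≢v (>⇒≢ v<s)) (degreeIn-star-below c (suc s) p c≢v (m<n⇒m<1+n v<s))

degreeIn-star-leaf : ∀ c s p {v} → c ≢ v → s ≤ v → v < s + p → degreeIn (star c s p) v ≡ 1
degreeIn-star-leaf c s zero    c≢v s≤v v<s+0 = contradiction (subst (_ <_) (+-identityʳ s) v<s+0) (≤⇒≯ s≤v)
degreeIn-star-leaf c s (suc p) {v} c≢v s≤v v<s+p with v ≟ s
... | yes refl = cong₂ _+_ (incident-right c s) (degreeIn-star-below c (suc s) p c≢v (n<1+n s))
... | no v≢s   = cong₂ _+_ (incident-miss c≢v (≢-sym v≢s))
                           (degreeIn-star-leaf c (suc s) p c≢v (≤∧≢⇒< s≤v (≢-sym v≢s)) (subst (v <_) (+-suc s p) v<s+p))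

hyperZagreb-star : ∀ d c s p {a b} → d c ≡ a → (∀ {v} → s ≤ v → v < s + p → d v ≡ b) →
                   hyperZagreb d (star c s p) ≡ p * ((a + b) * (a + b))
hyperZagreb-star d c s zero    d≡a d≡b = refl
hyperZagreb-star d c s (suc p) d≡a d≡b =
  cong₂ _+_ (cong₂ (λ x y → (x + y) * (x + y)) d≡a (d≡b ≤-refl (m<m+n s (s≤s z≤n))))
            (hyperZagreb-star d c (suc s) p d≡a (λ {v} s<v v< → d≡b (<⇒≤ s<v) (subst (v <_) (sym (+-suc s p)) v<)))

edges-Cmp : ∀ N p → edges (Cmp (2 + N) p) ≡ cycle N ++ star 0 (2 + N) p
edges-Cmp N p = cong₂ _++_ (cycleEdges≡cycle N)
                           (trans (map-upTo _ p) (applyUpTo-star 0 (2 + N) p (λ i → refl)))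

deg-Cmp : ∀ N p v → deg (Cmp (2 + N) p) v ≡ degreeIn (cycle N) v + degreeIn (star 0 (2 + N) p) v
deg-Cmp N p v = trans (deg≡degreeIn (Cmp (2 + N) p) v)
                      (trans (cong (λ es → degreeIn es v) (edges-Cmp N p)) (degreeIn-++ (cycle N) _ v))

deg-Cmp-root : ∀ N p → deg (Cmp (2 + N) p) 0 ≡ 2 + p
deg-Cmp-root N p = trans (deg-Cmp N p 0) (cong₂ _+_ (degreeIn-cycle N z≤n) (degreeIn-star-centre 0 _ p))

deg-Cmp-cycle : ∀ N p {v} → 0 < v → v ≤ suc N → deg (Cmp (2 + N) p) v ≡ 2
deg-Cmp-cycle N p {v} 0<v v≤1+N =
  trans (deg-Cmp N p v) (cong₂ _+_ (degreeIn-cycle N v≤1+N) (degreeIn-star-below 0 _ p (<⇒≢ 0<v) (s≤s v≤1+N)))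

deg-Cmp-pendant : ∀ N p {v} → 2 + N ≤ v → v < 2 + N + p → deg (Cmp (2 + N) p) v ≡ 1
deg-Cmp-pendant N p {v} 2+N≤v v<2+N+p =
  trans (deg-Cmp N p v) (cong₂ _+_ (degreeIn-cycle-above N 2+N≤v)
                                   (degreeIn-star-leaf 0 _ p (<⇒≢ (≤-trans (s≤s z≤n) 2+N≤v)) 2+N≤v v<2+N+p))

hmCmp : ℕ → ℕ → ℕ
hmCmp N p = 2 * ((p + 4) * (p + 4)) + N * 16 + p * ((p + 3) * (p + 3))

HM-Cmp : ∀ N p → HM (Cmp (2 + N) p) ≡ hmCmp N p
HM-Cmp N p = begin
  HM (Cmp (2 + N) p)
    ≡⟨ cong (hyperZagreb d) (edges-Cmp N p) ⟩
  hyperZagreb d (cycle N ++ star 0 (2 + N) p)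
    ≡⟨ hyperZagreb-++ d (cycle N) _ ⟩
  hyperZagreb d (cycle N) + hyperZagreb d (star 0 (2 + N) p)
    ≡⟨ cong (_+ hyperZagreb d (star 0 (2 + N) p)) (hyperZagreb-++ d (path 0 (suc N)) _) ⟩
  (sq (d 0) (d 1) + hyperZagreb d (path 1 N) + (sq (d (suc N)) (d 0) + 0)) + hyperZagreb d (star 0 (2 + N) p)
    ≡⟨ cong₂ _+_ (cong₂ _+_ (cong₂ _+_ (cong₂ sq root (cyc (s≤s z≤n) (s≤s z≤n)))
                                       (hyperZagreb-path d 1 N cyc))
                            (cong (_+ 0) (cong₂ sq (cyc (s≤s z≤n) ≤-refl) root)))
                 (hyperZagreb-star d 0 (2 + N) p root (deg-Cmp-pendant N p)) ⟩
  (sq (2 + p) 2 + N * 16 + (sq 2 (2 + p) + 0)) + p * sq (2 + p) 1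
    ≡⟨ collect N p ⟩
  hmCmp N p ∎
  where
  open ≡-Reasoning
  d : ℕ → ℕ
  d = deg (Cmp (2 + N) p)
  sq : ℕ → ℕ → ℕ
  sq a b = (a + b) * (a + b)
  root : d 0 ≡ 2 + p
  root = deg-Cmp-root N p
  cyc : ∀ {v} → 0 < v → v ≤ suc N → d v ≡ 2
  cyc = deg-Cmp-cycle N p
  collect : ∀ n q → ((2 + q + 2) * (2 + q + 2) + n * 16 + ((2 + (2 + q)) * (2 + (2 + q)) + 0))
                    + q * ((2 + q + 1) * (2 + q + 1))
                  ≡ 2 * ((q + 4) * (q + 4)) + n * 16 + q * ((q + 3) * (q + 3))
  collect = solve-∀

hmCmp-shorter-cycle : ∀ N p → hmCmp (suc N) p < hmCmp N (p + 1)
hmCmp-shorter-cycle N p =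
  subst (hmCmp (suc N) p <_) (sym (increment N p)) (m<m+n (hmCmp (suc N) p) (s≤s z≤n))
  where
  increment : ∀ n q → 2 * ((q + 1 + 4) * (q + 1 + 4)) + n * 16 + (q + 1) * ((q + 1 + 3) * (q + 1 + 3))
                    ≡ 2 * ((q + 4) * (q + 4)) + suc n * 16 + q * ((q + 3) * (q + 3))
                      + suc (3 * q * q + 19 * q + 17)
  increment = solve-∀

lemma2p9 : (m n : ℕ) → 4 ≤ m → m < n →
           HM (Cmp m (n ∸ m)) < HM (Cmp (m ∸ 1) (n ∸ m + 1))
lemma2p9 m@(suc (suc (suc (suc k)))) n (s≤s (s≤s (s≤s (s≤s _)))) _ = begin-strict
  HM (Cmp m (n ∸ m))                 ≡⟨ HM-Cmp (2 + k) (n ∸ m) ⟩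
  hmCmp (2 + k) (n ∸ m)              <⟨ hmCmp-shorter-cycle (1 + k) (n ∸ m) ⟩
  hmCmp (1 + k) (n ∸ m + 1)          ≡⟨ HM-Cmp (1 + k) (n ∸ m + 1) ⟨
  HM (Cmp (m ∸ 1) (n ∸ m + 1))       ∎
  where open ≤-Reasoning
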